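{- Let $\Gamma$ be a recursive specification that is well formed, and let $A$ be an automaton whose transition relation is $\mathrm{trans}\,A = \mathrm{seqp\_sos}\,\Gamma$ and whose initial states satisfy $\mathrm{control\_within}\ \Gamma\ (\mathrm{init}\,A)$. Let $I$ be any predicate on actions. If $(\xi, p) \in \mathrm{reachable}\ A\ I$ and $p' \in \mathrm{sterms}\ \Gamma\ p$, then $p' \in \mathrm{cterms}\ \Gamma$.
   Context: Sequential process terms (parameterized by a type $K$ of data states, a type of process names, and a type of labels) are built from the constructors: assignment $\{l\}[\![u]\!]\,p$ with $u:K\to K$; guard/bind $\{l\}\langle g\rangle\,p$ with $g:K\to \mathcal P(K)$; $\{l\}\mathrm{unicast}(s_{id},s_{msg}).p \triangleright q$; $\{l\}\mathrm{broadcast}(s_{msg}).p$; $\{l\}\mathrm{groupcast}(s_{ids},s_{msg}).p$; $\{l\}\mathrm{send}(s_{msg}).p$; $\{l\}\mathrm{receive}(u_{msg}).p$ with $u_{msg}:\mathrm{msg}\to K\to K$; $\{l\}\mathrm{deliver}(s_{data}).p$; choice $p\oplus q$; and $\mathrm{call}(pn)$. Here $s_{id},s_{ids},s_{msg},s_{data}$ are functions of the data state. A recursive specification $\Gamma$ maps process names to terms. States are pairs $(\xi,p)$ of a data state and a term. The transition relation $\mathrm{seqp\_sos}\,\Gamma$ is the smallest set of triples (state, action, state) such that: $(\xi,\{l\}[\![u]\!]p)\xrightarrow{\tau}(u\,\xi,p)$; $(\xi,\{l\}\langle g\rangle p)\xrightarrow{\tau}(\xi',p)$ for every $\xi'\in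 g\,\xi$; $(\xi,\{l\}\mathrm{unicast}(s_{id},s_{msg}).p\triangleright q)\xrightarrow{\mathrm{unicast}\,(s_{id}\xi)\,(s_{msg}\xi)}(\xi,p)$ and $\xrightarrow{\neg\mathrm{unicast}\,(s_{id}\xi)}(\xi,q)$; $(\xi,\{l\}\mathrm{broadcast}(s_{msg}).p)\xrightarrow{\mathrm{broadcast}(s_{msg}\xi)}(\xi,p)$; $(\xi,\{l\}\mathrm{groupcast}(s_{ids},s_{msg}).p)\xrightarrow{\mathrm{groupcast}(s_{ids}\xi)(s_{msg}\xi)}(\xi,p)$; $(\xi,\{l\}\mathrm{send}(s_{msg}).p)\xrightarrow{\mathrm{send}(s_{msg}\xi)}(\xi,p)$; $(\xi,\{l\}\mathrm{receive}(u_{msg}).p)\xrightarrow{\mathrm{receive}\,m}(u_{msg}\,m\,\xi,p)$ for every message $m$; $(\xi,\{l\}\mathrm{deliver}(s_{data}).p)\xrightarrow{\mathrm{deliver}(s_{data}\xi)}(\xi,p)$; $p\oplus q$ has every transition of $(\xi,p)$ and of $(\xi,q)$; $(\xi,\mathrm{call}(pn))$ has every transition of $(\xi,\Gamma\,pn)$. An automaton is a pair of a set $\mathrm{init}$ of initial states and a set $\mathrm{trans}$ of transitions. For a predicate $I$ on actions, $\mathrm{reachable}\ A\ I$ is the smallest set containing $\mathrm{init}\,A$ and containing $s'$ whenever $s$ is in it, $(s,a,s')\in\mathrm{trans}\,A$ and $I\,a$. The relation $\leadsto_\Gamma$ is the smallest relation with $p_1\oplus p_2\leadsto_\Gamma p_1$,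 $p_1\oplus p_2\leadsto_\Gamma p_2$, and $\mathrm{call}(pn)\leadsto_\Gamma \Gamma\,pn$. $\Gamma$ is well formed if the inverse of $\leadsto_\Gamma$ is well founded (there is no infinite chain $p_0\leadsto_\Gamma p_1\leadsto_\Gamma\cdots$). For well-formed $\Gamma$: $\mathrm{sterms}\,\Gamma\,(p_1\oplus p_2)=\mathrm{sterms}\,\Gamma\,p_1\cup\mathrm{sterms}\,\Gamma\,p_2$, $\mathrm{sterms}\,\Gamma\,(\mathrm{call}(pn))=\mathrm{sterms}\,\Gamma\,(\Gamma\,pn)$, and $\mathrm{sterms}\,\Gamma\,p=\{p\}$ otherwise. Further, $\mathrm{dterms}\,\Gamma\,(p_1\oplus p_2)=\mathrm{dterms}\,\Gamma\,p_1\cup\mathrm{dterms}\,\Gamma\,p_2$, $\mathrm{dterms}\,\Gamma\,(\mathrm{call}(pn))=\mathrm{dterms}\,\Gamma\,(\Gamma\,pn)$, $\mathrm{dterms}\,\Gamma\,(\{l\}\mathrm{unicast}(s_{id},s_{msg}).p\triangleright q)=\mathrm{sterms}\,\Gamma\,p\cup\mathrm{sterms}\,\Gamma\,q$, and for every other prefix constructor (assignment, guard, broadcast, groupcast, send, receive, deliver) with continuation $p$, $\mathrm{dterms}$ of it is $\mathrm{sterms}\,\Gamma\,p$. The set $\mathrm{cterms}\,\Gamma$ is the smallest set such that $p\in\mathrm{sterms}\,\Gamma\,(\Gamma\,pn)$ implies $p\in\mathrm{cterms}\,\Gamma$ (for any process name $pn$), and $pp\in\mathrm{cterms}\,\Gamma$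 and $p\in\mathrm{dterms}\,\Gamma\,pp$ imply $p\in\mathrm{cterms}\,\Gamma$. Finally, $\mathrm{control\_within}\ \Gamma\ \sigma$ means that for every $(\xi,p)\in\sigma$ there is a process name $pn$ such that $p$ is a subterm of $\Gamma\,pn$. -}

module Defs where

open import Data.Product using (_×_; _,_; Σ; ∃)
open import Data.Unit using (⊤)
open import Data.Empty using (⊥)
open import Function.Bundles using (_⇔_)
open import Induction.WellFounded using (WellFounded)

𝒫 : Set → Set₁
𝒫 A = A → Set

-- Sequential process terms over data states K, process names P, labels L,
-- node addresses Ip, messages Msg and delivered data Data.
data SeqP (K P L Ip Msg Data : Set) : Set₁ where
  assign    : L → (K → K) → SeqP K P L Ip Msg Data → SeqP K P L Ip Msg Data
  guard     : L → (K → 𝒫 K) → SeqP K P L Ip Msg Data → SeqP K P L Ip Msg Data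
  unicast   : L → (K → Ip) → (K → Msg) → SeqP K P L Ip Msg Data → SeqP K P L Ip Msg Data → SeqP K P L Ip Msg Data
  broadcast : L → (K → Msg) → SeqP K P L Ip Msg Data → SeqP K P L Ip Msg Data
  groupcast : L → (K → 𝒫 Ip) → (K → Msg) → SeqP K P L Ip Msg Data → SeqP K P L Ip Msg Data
  send      : L → (K → Msg) → SeqP K P L Ip Msg Data → SeqP K P L Ip Msg Data
  receive   : L → (Msg → K → K) → SeqP K P L Ip Msg Data → SeqP K P L Ip Msg Data
  deliver   : L → (K → Data) → SeqP K P L Ip Msg Data → SeqP K P L Ip Msg Data
  _⊕_       : SeqP K P L Ip Msg Data → SeqP K P L Ip Msg Data → SeqP K P L Ip Msg Data
  call      : P → SeqP K P L Ip Msg Data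

Spec : (K P L Ip Msg Data : Set) → Set₁
Spec K P L Ip Msg Data = P → SeqP K P L Ip Msg Data

data SeqAction (Ip Msg Data : Set) : Set₁ where
  τ          : SeqAction Ip Msg Data
  unicastA   : Ip → Msg → SeqAction Ip Msg Data
  notunicast : Ip → SeqAction Ip Msg Data
  broadcastA : Msg → SeqAction Ip Msg Data
  groupcastA : 𝒫 Ip → Msg → SeqAction Ip Msg Data
  sendA      : Msg → SeqAction Ip Msg Data
  receiveA   : Msg → SeqAction Ip Msg Data
  deliverA   : Data → SeqAction Ip Msg Data

module _ {K P L Ip Msg Data : Set} where

  private
    T = SeqP K P L Ip Msg Data
    Act = SeqAction Ip Msg Data

  State : Set₁
  State = K × T

  data SeqpSos (Γ : Spec K P L Ip Msg Data) : State → Act → State → Set₁ where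
    s-assign : ∀ {ξ l u p} → SeqpSos Γ (ξ , assign l u p) τ (u ξ , p)
    s-guard  : ∀ {ξ ξ' l g p} → g ξ ξ' → SeqpSos Γ (ξ , guard l g p) τ (ξ' , p)
    s-ucast  : ∀ {ξ l sid smsg p q} →
               SeqpSos Γ (ξ , unicast l sid smsg p q) (unicastA (sid ξ) (smsg ξ)) (ξ , p)
    s-nucast : ∀ {ξ l sid smsg p q} →
               SeqpSos Γ (ξ , unicast l sid smsg p q) (notunicast (sid ξ)) (ξ , q)
    s-bcast  : ∀ {ξ l smsg p} → SeqpSos Γ (ξ , broadcast l smsg p) (broadcastA (smsg ξ)) (ξ , p)
    s-gcast  : ∀ {ξ l sids smsg p} →
               SeqpSos Γ (ξ , groupcast l sids smsg p) (groupcastA (sids ξ) (smsg ξ)) (ξ , p)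
    s-send   : ∀ {ξ l smsg p} → SeqpSos Γ (ξ , send l smsg p) (sendA (smsg ξ)) (ξ , p)
    s-recv   : ∀ {ξ l umsg p} (m : Msg) →
               SeqpSos Γ (ξ , receive l umsg p) (receiveA m) (umsg m ξ , p)
    s-deliv  : ∀ {ξ l sdata p} → SeqpSos Γ (ξ , deliver l sdata p) (deliverA (sdata ξ)) (ξ , p)
    s-choiceL : ∀ {ξ p q a s'} → SeqpSos Γ (ξ , p) a s' → SeqpSos Γ (ξ , p ⊕ q) a s'
    s-choiceR : ∀ {ξ p q a s'} → SeqpSos Γ (ξ , q) a s' → SeqpSos Γ (ξ , p ⊕ q) a s'
    s-call   : ∀ {ξ pn a s'} → SeqpSos Γ (ξ , Γ pn) a s' → SeqpSos Γ (ξ , call pn) a s'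

  data Step (Γ : Spec K P L Ip Msg Data) : T → T → Set₁ where
    st-l    : ∀ {p q} → Step Γ (p ⊕ q) p
    st-r    : ∀ {p q} → Step Γ (p ⊕ q) q
    st-call : ∀ {pn} → Step Γ (call pn) (Γ pn)

  WellFormed : Spec K P L Ip Msg Data → Set₁
  WellFormed Γ = WellFounded (λ q p → Step Γ p q)

  NotChoiceCall : T → Set
  NotChoiceCall (_ ⊕ _) = ⊥
  NotChoiceCall (call _) = ⊥
  NotChoiceCall _ = ⊤

  -- membership p' ∈ sterms Γ p (least relation satisfying the defining equations)
  data STerm (Γ : Spec K P L Ip Msg Data) : T → T → Set₁ where
    sterm-l    : ∀ {p' p q} → STerm Γ p' p → STerm Γ p' (p ⊕ q)
    sterm-r    : ∀ {p' p q} → STerm Γ p' q → STerm Γ p' (p ⊕ q)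
    sterm-call : ∀ {p' pn} → STerm Γ p' (Γ pn) → STerm Γ p' (call pn)
    sterm-self : ∀ {p} → NotChoiceCall p → STerm Γ p p

  data DTerm (Γ : Spec K P L Ip Msg Data) : T → T → Set₁ where
    dterm-l    : ∀ {p' p q} → DTerm Γ p' p → DTerm Γ p' (p ⊕ q)
    dterm-r    : ∀ {p' p q} → DTerm Γ p' q → DTerm Γ p' (p ⊕ q)
    dterm-call : ∀ {p' pn} → DTerm Γ p' (Γ pn) → DTerm Γ p' (call pn)
    dterm-assign : ∀ {p' l u p} → STerm Γ p' p → DTerm Γ p' (assign l u p)
    dterm-guard  : ∀ {p' l g p} → STerm Γ p' p → DTerm Γ p' (guard l g p)
    dterm-ucastp : ∀ {p' l sid smsg p q} → STerm Γ p' p → DTerm Γ p' (unicast l sid smsg p q)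
    dterm-ucastq : ∀ {p' l sid smsg p q} → STerm Γ p' q → DTerm Γ p' (unicast l sid smsg p q)
    dterm-bcast  : ∀ {p' l smsg p} → STerm Γ p' p → DTerm Γ p' (broadcast l smsg p)
    dterm-gcast  : ∀ {p' l sids smsg p} → STerm Γ p' p → DTerm Γ p' (groupcast l sids smsg p)
    dterm-send   : ∀ {p' l smsg p} → STerm Γ p' p → DTerm Γ p' (send l smsg p)
    dterm-recv   : ∀ {p' l umsg p} → STerm Γ p' p → DTerm Γ p' (receive l umsg p)
    dterm-deliv  : ∀ {p' l sdata p} → STerm Γ p' p → DTerm Γ p' (deliver l sdata p)

  data CTerm (Γ : Spec K P L Ip Msg Data) : T → Set₁ where
    cterm-spec : ∀ {p} pn → STerm Γ p (Γ pn) → CTerm Γ p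
    cterm-step : ∀ {p pp} → CTerm Γ pp → DTerm Γ p pp → CTerm Γ p

  data Subterm : T → T → Set₁ where
    sub-refl : ∀ {p} → Subterm p p
    sub-assign : ∀ {p l u q} → Subterm p q → Subterm p (assign l u q)
    sub-guard  : ∀ {p l g q} → Subterm p q → Subterm p (guard l g q)
    sub-ucastp : ∀ {p l sid smsg q r} → Subterm p q → Subterm p (unicast l sid smsg q r)
    sub-ucastq : ∀ {p l sid smsg q r} → Subterm p r → Subterm p (unicast l sid smsg q r)
    sub-bcast  : ∀ {p l smsg q} → Subterm p q → Subterm p (broadcast l smsg q)
    sub-gcast  : ∀ {p l sids smsg q} → Subterm p q → Subterm p (groupcast l sids smsg q)
    sub-send   : ∀ {p l smsg q} → Subterm p q → Subterm p (send l smsg q)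
    sub-recv   : ∀ {p l umsg q} → Subterm p q → Subterm p (receive l umsg q)
    sub-deliv  : ∀ {p l sdata q} → Subterm p q → Subterm p (deliver l sdata q)
    sub-l      : ∀ {p q r} → Subterm p q → Subterm p (q ⊕ r)
    sub-r      : ∀ {p q r} → Subterm p r → Subterm p (q ⊕ r)

  ControlWithin : Spec K P L Ip Msg Data → (State → Set₁) → Set₁
  ControlWithin Γ σ = ∀ ξ p → σ (ξ , p) → ∃ λ pn → Subterm p (Γ pn)

record Automaton (S A : Set₁) : Set₂ where
  field
    init  : S → Set₁
    trans : S → A → S → Set₁
open Automaton public

data Reachable {S A : Set₁} (𝒜 : Automaton S A) (I : A → Set₁) : S → Set₁ where
  r-init : ∀ {s} → init 𝒜 s → Reachable 𝒜 I s
  r-step : ∀ {s a s'} → Reachable 𝒜 I s → trans 𝒜 s a s' → I a → Reachable 𝒜 I s'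

-- The invariant is that every sterm of the control term is a cterm. It holds
-- initially because initial control terms are subterms of Γ pn, and passing
-- to the continuation of a prefix (whether by a transition or by descending to
-- a subterm) only moves to dterms of the current term, under which cterms is
-- closed by definition.
module Submission where

open import Defs
open import Data.Product using (_,_)
open import Data.Unit using (tt)
open import Function.Bundles using (_⇔_; Equivalence)

module _ {K P L Ip Msg Data : Set} (Γ : Spec K P L Ip Msg Data) where

  private
    T = SeqP K P L Ip Msg Data

  STermsInCTerms : T → Set₁
  STermsInCTerms p = ∀ {p'} → STerm Γ p' p → CTerm Γ p'

  dterm-cterm : ∀ {p p'} → STermsInCTerms p → DTerm Γ p' p → CTerm Γ p'
  dterm-cterm h (dterm-l d)        = dterm-cterm (λ t → h (sterm-l t)) d
  dterm-cterm h (dterm-r d)        = dterm-cterm (λ t → h (sterm-r t)) d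
  dterm-cterm h (dterm-call d)     = dterm-cterm (λ t → h (sterm-call t)) d
  dterm-cterm h d@(dterm-assign _) = cterm-step (h (sterm-self tt)) d
  dterm-cterm h d@(dterm-guard _)  = cterm-step (h (sterm-self tt)) d
  dterm-cterm h d@(dterm-ucastp _) = cterm-step (h (sterm-self tt)) d
  dterm-cterm h d@(dterm-ucastq _) = cterm-step (h (sterm-self tt)) d
  dterm-cterm h d@(dterm-bcast _)  = cterm-step (h (sterm-self tt)) d
  dterm-cterm h d@(dterm-gcast _)  = cterm-step (h (sterm-self tt)) d
  dterm-cterm h d@(dterm-send _)   = cterm-step (h (sterm-self tt)) d
  dterm-cterm h d@(dterm-recv _)   = cterm-step (h (sterm-self tt)) d
  dterm-cterm h d@(dterm-deliv _)  = cterm-step (h (sterm-self tt)) d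

  STermsInCTerms-dterms : ∀ {p q} → STermsInCTerms p →
                          (∀ {q'} → STerm Γ q' q → DTerm Γ q' p) → STermsInCTerms q
  STermsInCTerms-dterms h sterms⊆dterms t = dterm-cterm h (sterms⊆dterms t)

  STermsInCTerms-subterm : ∀ {p q} → Subterm p q → STermsInCTerms q → STermsInCTerms p
  STermsInCTerms-subterm sub-refl       h = h
  STermsInCTerms-subterm (sub-assign s) h = STermsInCTerms-subterm s (STermsInCTerms-dterms h dterm-assign)
  STermsInCTerms-subterm (sub-guard s)  h = STermsInCTerms-subterm s (STermsInCTerms-dterms h dterm-guard)
  STermsInCTerms-subterm (sub-ucastp s) h = STermsInCTerms-subterm s (STermsInCTerms-dterms h dterm-ucastp)
  STermsInCTerms-subterm (sub-ucastq s) h = STermsInCTerms-subterm s (STermsInCTerms-dterms h dterm-ucastq)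
  STermsInCTerms-subterm (sub-bcast s)  h = STermsInCTerms-subterm s (STermsInCTerms-dterms h dterm-bcast)
  STermsInCTerms-subterm (sub-gcast s)  h = STermsInCTerms-subterm s (STermsInCTerms-dterms h dterm-gcast)
  STermsInCTerms-subterm (sub-send s)   h = STermsInCTerms-subterm s (STermsInCTerms-dterms h dterm-send)
  STermsInCTerms-subterm (sub-recv s)   h = STermsInCTerms-subterm s (STermsInCTerms-dterms h dterm-recv)
  STermsInCTerms-subterm (sub-deliv s)  h = STermsInCTerms-subterm s (STermsInCTerms-dterms h dterm-deliv)
  STermsInCTerms-subterm (sub-l s)      h = STermsInCTerms-subterm s (λ t → h (sterm-l t))
  STermsInCTerms-subterm (sub-r s)      h = STermsInCTerms-subterm s (λ t → h (sterm-r t))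

  seqp-sos-dterms : ∀ {ξ ξ' p q a q'} → SeqpSos Γ (ξ , p) a (ξ' , q) →
                    STerm Γ q' q → DTerm Γ q' p
  seqp-sos-dterms s-assign      = dterm-assign
  seqp-sos-dterms (s-guard _)   = dterm-guard
  seqp-sos-dterms s-ucast       = dterm-ucastp
  seqp-sos-dterms s-nucast      = dterm-ucastq
  seqp-sos-dterms s-bcast       = dterm-bcast
  seqp-sos-dterms s-gcast       = dterm-gcast
  seqp-sos-dterms s-send        = dterm-send
  seqp-sos-dterms (s-recv _)    = dterm-recv
  seqp-sos-dterms s-deliv       = dterm-deliv
  seqp-sos-dterms (s-choiceL s) t = dterm-l (seqp-sos-dterms s t)
  seqp-sos-dterms (s-choiceR s) t = dterm-r (seqp-sos-dterms s t)
  seqp-sos-dterms (s-call s)    t = dterm-call (seqp-sos-dterms s t)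

  STermsInCTerms-reachable :
    (𝒜 : Automaton (State {K} {P} {L} {Ip} {Msg} {Data}) (SeqAction Ip Msg Data))
    (I : SeqAction Ip Msg Data → Set₁) →
    (∀ {s a s'} → trans 𝒜 s a s' → SeqpSos Γ s a s') →
    ControlWithin Γ (init 𝒜) →
    ∀ {ξ p} → Reachable 𝒜 I (ξ , p) → STermsInCTerms p
  STermsInCTerms-reachable 𝒜 I sound cw (r-init {s = ξ , p} i) with cw ξ p i
  ... | pn , sub = STermsInCTerms-subterm sub (cterm-spec pn)
  STermsInCTerms-reachable 𝒜 I sound cw (r-step {s = _ , _} r t _) =
    STermsInCTerms-dterms (STermsInCTerms-reachable 𝒜 I sound cw r)
                          (seqp-sos-dterms (sound t))

lemma1 : {K P L Ip Msg Data : Set}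
         (Γ : Spec K P L Ip Msg Data)
         (𝒜 : Automaton (State {K} {P} {L} {Ip} {Msg} {Data}) (SeqAction Ip Msg Data))
         (I : SeqAction Ip Msg Data → Set₁) →
         WellFormed Γ →
         (∀ s a s' → trans 𝒜 s a s' ⇔ SeqpSos Γ s a s') →
         ControlWithin Γ (init 𝒜) →
         ∀ ξ p p' → Reachable 𝒜 I (ξ , p) → STerm Γ p' p → CTerm Γ p'
lemma1 Γ 𝒜 I _ trans⇔sos cw ξ p p' r =
  STermsInCTerms-reachable Γ 𝒜 I (λ t → Equivalence.to (trans⇔sos _ _ _) t) cw r
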